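{- Let $w\in S_n$ and suppose $u'$ is a child of the node $u$ in the transition tree $\mathcal{T}(w)$. Then $N_{2143,n}(u)-N_{2143,n}(u')\leq 2n^3+3n^2-n$.
   Context: For $v\in S_n$, $N_{2143,n}(v)$ is the number of index tuples $i_1<i_2<i_3<i_4$ with $v(i_2)<v(i_1)<v(i_4)<v(i_3)$. For $w\in S_n$, the Rothe diagram is $D(w)=\{(i,j): j<w(i),\ i<w^{ -1}(j)\}$ (matrix coordinates). The dominant component is the connected component (via edge-adjacency) of $D(w)$ containing $(1,1)$, if $(1,1)\in D(w)$. The essential set is $\{(i,j)\in D(w): (i+1,j),(i,j+1)\notin D(w)\}$. The accessible box is, among essential set boxes not in the dominant component, the one in the largest row, and among those the one in the largest column. $w$ is vexillary if $N_{2143,n}(w)=0$. The transition tree $\mathcal{T}(w)$ is the rooted tree with root labelled $w$ defined recursively: if $w$ is vexillary, the root is a leaf. Otherwise let $(x,y)$ be the accessible box, $x'=w^{ -1}(y)$, $y'=w(x)$. A pivot is an index $c<x$ with $w(c)<y$ such that no $c'$ with $c<c'<x$ has $w(c)<w(c')<y$. For each pivot $c$ the root has a child, the root of $\mathcal{T}(w^{(c)})$, where $w^{(c)}$ agrees with $w$ outside positions $c,x,x'$ and $w^{(c)}(c)=y$, $w^{(c)}(x)=w(c)$, $w^{(c)}(x')=y'$. -}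

module Defs where

open import Data.Nat using (ℕ; zero; suc; _+_)
open import Data.Fin using (Fin; zero; suc; toℕ; _<_; _≤_; _≟_) renaming (_<?_ to _<ᶠ?_)
open import Data.Fin.Permutation using (Permutation′; _⟨$⟩ʳ_; _⟨$⟩ˡ_)
open import Data.List using (List; map; allFin)
open import Data.Nat.ListAction using (sum)
open import Data.Product using (_×_; _,_)
open import Data.Sum using (_⊎_)
open import Relation.Nullary using (Dec; yes; no; ¬_)
open import Relation.Nullary.Decidable using (_×-dec_)
open import Relation.Binary.PropositionalEquality using (_≡_)

-- Permutations of {1..n}, encoded 0-indexed as bijections Fin n → Fin n.
Perm : ℕ → Set
Perm n = Permutation′ n

ind : ∀ {p} {P : Set p} → Dec P → ℕ
ind (yes _) = 1
ind (no _)  = 0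

Σ[_]_ : (n : ℕ) → (Fin n → ℕ) → ℕ
Σ[ n ] f = sum (map f (allFin n))

Pat2143 : ∀ {n} → Perm n → Fin n → Fin n → Fin n → Fin n → Set
Pat2143 v i₁ i₂ i₃ i₄ =
  (i₁ < i₂) × (i₂ < i₃) × (i₃ < i₄) ×
  ((v ⟨$⟩ʳ i₂) < (v ⟨$⟩ʳ i₁)) × ((v ⟨$⟩ʳ i₁) < (v ⟨$⟩ʳ i₄)) × ((v ⟨$⟩ʳ i₄) < (v ⟨$⟩ʳ i₃))

pat2143? : ∀ {n} (v : Perm n) i₁ i₂ i₃ i₄ → Dec (Pat2143 v i₁ i₂ i₃ i₄)
pat2143? v i₁ i₂ i₃ i₄ =
  (i₁ <ᶠ? i₂) ×-dec (i₂ <ᶠ? i₃) ×-dec (i₃ <ᶠ? i₄) ×-dec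
  ((v ⟨$⟩ʳ i₂) <ᶠ? (v ⟨$⟩ʳ i₁)) ×-dec ((v ⟨$⟩ʳ i₁) <ᶠ? (v ⟨$⟩ʳ i₄)) ×-dec
  ((v ⟨$⟩ʳ i₄) <ᶠ? (v ⟨$⟩ʳ i₃))

N2143 : (n : ℕ) → Perm n → ℕ
N2143 n v = Σ[ n ] λ i₁ → Σ[ n ] λ i₂ → Σ[ n ] λ i₃ → Σ[ n ] λ i₄ → ind (pat2143? v i₁ i₂ i₃ i₄)

Vexillary : ∀ {n} → Perm n → Set
Vexillary {n} w = N2143 n w ≡ 0

-- Rothe diagram: (i,j) ∈ D(w) iff j < w(i) and i < w⁻¹(j)  (matrix coordinates, 0-indexed)
InD : ∀ {n} → Perm n → Fin n → Fin n → Set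
InD w i j = (j < (w ⟨$⟩ʳ i)) × (i < (w ⟨$⟩ˡ j))

Adj : ∀ {n} → Fin n → Fin n → Fin n → Fin n → Set
Adj i j i' j' =
  ((toℕ i' ≡ suc (toℕ i)) × (j' ≡ j)) ⊎ ((toℕ i ≡ suc (toℕ i')) × (j' ≡ j)) ⊎
  ((i' ≡ i) × (toℕ j' ≡ suc (toℕ j))) ⊎ ((i' ≡ i) × (toℕ j ≡ suc (toℕ j')))

data InDom {n : ℕ} (w : Perm n) : Fin n → Fin n → Set where
  base : ∀ {i j} → toℕ i ≡ 0 → toℕ j ≡ 0 → InD w i j → InDom w i j
  step : ∀ {i j i' j'} → InDom w i j → Adj i j i' j' → InD w i' j' → InDom w i' j'

-- essential set: (i,j) ∈ D(w) with (i+1,j) ∉ D(w) and (i,j+1) ∉ D(w)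
-- (boxes outside the n×n grid are not in D(w))
Essential : ∀ {n} → Perm n → Fin n → Fin n → Set
Essential w i j =
  InD w i j ×
  (∀ i' → toℕ i' ≡ suc (toℕ i) → ¬ InD w i' j) ×
  (∀ j' → toℕ j' ≡ suc (toℕ j) → ¬ InD w i j')

EssNonDom : ∀ {n} → Perm n → Fin n → Fin n → Set
EssNonDom w i j = Essential w i j × ¬ InDom w i j

Accessible : ∀ {n} → Perm n → Fin n → Fin n → Set
Accessible w x y =
  EssNonDom w x y ×
  (∀ i j → EssNonDom w i j → (i < x) ⊎ ((i ≡ x) × (j ≤ y)))

Pivot : ∀ {n} → Perm n → Fin n → Fin n → Fin n → Set
Pivot w x y c =
  (c < x) × ((w ⟨$⟩ʳ c) < y) ×
  (∀ c' → c < c' → c' < x → ¬ (((w ⟨$⟩ʳ c) < (w ⟨$⟩ʳ c')) × ((w ⟨$⟩ʳ c') < y)))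

transitionFun : ∀ {n} → Perm n → (x y c : Fin n) → Fin n → Fin n
transitionFun w x y c i with i ≟ c
... | yes _ = y
... | no _ with i ≟ x
...   | yes _ = w ⟨$⟩ʳ c
...   | no _ with i ≟ (w ⟨$⟩ˡ y)
...     | yes _ = w ⟨$⟩ʳ x
...     | no _  = w ⟨$⟩ʳ i

Child : ∀ {n} → Perm n → Perm n → Set
Child {n} u u' =
  ¬ Vexillary u ×
  Data.Product.∃ λ x → Data.Product.∃ λ y → Data.Product.∃ λ c →
    Accessible u x y × Pivot u x y c ×
    (∀ i → (u' ⟨$⟩ʳ i) ≡ transitionFun u x y c i)

data InTree {n : ℕ} (w : Perm n) : Perm n → Set where
  root  : InTree w w
  child : ∀ {u u'} → InTree w u → Child u u' → InTree w u'

module Submission where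

-- A child u′ of u agrees with u outside the three positions c, x and x′ = u⁻¹(y), and an
-- occurrence of 2143 in u that avoids them is also one in u′. Through a fixed position pass
-- at most 4·C(n,3) increasing quadruples, and 6·C(n,3) ≤ n³ by summing over the 3! orderings
-- of a triple. Hence N(u) − N(u′) ≤ 3·4·C(n,3) ≤ 2n³ ≤ 2n³ + 3n² − n; neither the tree nor
-- the choice of accessible box and pivot plays a role.

open import Defs
open import Data.Nat as ℕ using (ℕ)
import Data.Nat.Properties as ℕ
open import Relation.Binary.PropositionalEquality

module _ where
  open import Data.Nat using (zero; suc; _+_; _*_; _≤_; z≤n; s≤s)
  open import Data.Nat.Properties using
    (+-*-semiring; ≤-trans; ≤-reflexive; +-mono-≤; *-mono-≤; *-monoʳ-≤; *-monoˡ-≤; +-monoʳ-≤;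
     m≤m+n; m≤n+m; m≤n*m; *-identityʳ; module ≤-Reasoning)
  open import Data.Nat.Tactic.RingSolver using (solve-∀)
  open import Data.Fin using (Fin; zero; suc; _<_; _≟_; _<?_; punchIn)
  open import Data.Fin.Properties using (any?; punchInᵢ≢i; <-asym; <-trans)
  open import Data.Fin.Permutation using (_⟨$⟩ʳ_; _⟨$⟩ˡ_)
  open import Data.Vec.Functional using (_∷_; [])
  open import Data.List using (tabulate)
  open import Data.List.Properties using (map-tabulate)
  import Data.Nat.ListAction as List
  open import Data.Product using (_,_)
  open import Data.Sum using (_⊎_; inj₁; inj₂)
  open import Function using (_∘_)
  open import Relation.Nullary using (Dec; yes; no; ¬_; ¬?; contradiction)
  open import Algebra.Properties.Semiring.Sum +-*-semiring

  ind-pos : ∀ {p} {P : Set p} (d : Dec P) → P → 1 ≤ ind d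
  ind-pos (yes _) _  = s≤s z≤n
  ind-pos (no ¬p) p  = contradiction p ¬p

  ind≡1 : ∀ {p} {P : Set p} (d : Dec P) → P → ind d ≡ 1
  ind≡1 (yes _) _  = refl
  ind≡1 (no ¬p) p  = contradiction p ¬p

  ind≡0 : ∀ {p} {P : Set p} (d : Dec P) → ¬ P → ind d ≡ 0
  ind≡0 (yes p) ¬p = contradiction p ¬p
  ind≡0 (no _)  _  = refl

  ind≤1 : ∀ {p} {P : Set p} (d : Dec P) → ind d ≤ 1
  ind≤1 (yes _) = s≤s z≤n
  ind≤1 (no _)  = z≤n

  Σ≡∑ : ∀ n (f : Fin n → ℕ) → Σ[ n ] f ≡ ∑[ i < n ] f i
  Σ≡∑ n f = trans (cong List.sum (map-tabulate (λ i → i) f)) (sum-tabulate n f)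
    where
    sum-tabulate : ∀ m (g : Fin m → ℕ) → List.sum (tabulate g) ≡ ∑[ i < m ] g i
    sum-tabulate zero    g = refl
    sum-tabulate (suc m) g = cong (g zero +_) (sum-tabulate m (g ∘ suc))

  ∑-mono-≤ : ∀ {n} {f g : Fin n → ℕ} → (∀ i → f i ≤ g i) → ∑[ i < n ] f i ≤ ∑[ i < n ] g i
  ∑-mono-≤ {zero}  _   = z≤n
  ∑-mono-≤ {suc n} f≤g = +-mono-≤ (f≤g zero) (∑-mono-≤ (f≤g ∘ suc))

  term≤∑ : ∀ {n} (f : Fin n → ℕ) i → f i ≤ ∑[ j < n ] f j
  term≤∑ {suc n} f i = ≤-trans (m≤m+n (f i) _) (≤-reflexive (sym (sum-remove {i = i} f)))

  ∑-const : ∀ n k → ∑[ i < n ] k ≡ n * k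
  ∑-const zero    k = refl
  ∑-const (suc n) k = cong (k +_) (∑-const n k)

  ∑-*ˡ : ∀ {n} k (f : Fin n → ℕ) → ∑[ i < n ] (k * f i) ≡ k * ∑[ i < n ] f i
  ∑-*ˡ k f = sym (*-distribˡ-sum k f)

  ∑-*ʳ : ∀ {n} k (f : Fin n → ℕ) → ∑[ i < n ] (f i * k) ≡ (∑[ i < n ] f i) * k
  ∑-*ʳ k f = sym (*-distribʳ-sum k f)

  ∑-indicator : ∀ {n} (p : Fin n) → ∑[ i < n ] ind (i ≟ p) ≡ 1
  ∑-indicator {suc n} p = begin
    ∑[ i < suc n ] ind (i ≟ p)                      ≡⟨ sum-remove {i = p} (λ i → ind (i ≟ p)) ⟩
    ind (p ≟ p) + ∑[ j < n ] ind (punchIn p j ≟ p)  ≡⟨ cong₂ _+_ (ind≡1 (p ≟ p) refl) punched-out ⟩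
    1                                               ∎
    where
    open ≡-Reasoning
    punched-out : ∑[ j < n ] ind (punchIn p j ≟ p) ≡ 0
    punched-out = trans (sum-cong-≗ (λ j → ind≡0 (punchIn p j ≟ p) (punchInᵢ≢i p j))) (sum-replicate-zero n)

  ∑² : ∀ {n} → (Fin n → Fin n → ℕ) → ℕ
  ∑² {n} F = ∑[ a < n ] ∑[ b < n ] F a b

  ∑³ : ∀ {n} → (Fin n → Fin n → Fin n → ℕ) → ℕ
  ∑³ {n} F = ∑[ a < n ] ∑² (F a)

  ∑⁴ : ∀ {n} → (Fin n → Fin n → Fin n → Fin n → ℕ) → ℕ
  ∑⁴ {n} F = ∑[ a < n ] ∑³ (F a)

  ∑²-*ˡ : ∀ {n} k (F : Fin n → Fin n → ℕ) → ∑² (λ a b → k * F a b) ≡ k * ∑² F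
  ∑²-*ˡ {n} k F = trans (sum-cong-≗ (λ a → ∑-*ˡ k (F a))) (∑-*ˡ k (λ a → ∑[ b < n ] F a b))

  ∑³-*ˡ : ∀ {n} k (F : Fin n → Fin n → Fin n → ℕ) → ∑³ (λ a b c → k * F a b c) ≡ k * ∑³ F
  ∑³-*ˡ k F = trans (sum-cong-≗ (λ a → ∑²-*ˡ k (F a))) (∑-*ˡ k (λ a → ∑² (F a)))

  ∑³-distrib-+ : ∀ {n} (F G : Fin n → Fin n → Fin n → ℕ) →
    ∑³ (λ a b c → F a b c + G a b c) ≡ ∑³ F + ∑³ G
  ∑³-distrib-+ F G = trans
    (sum-cong-≗ (λ a → trans (sum-cong-≗ (λ b → ∑-distrib-+ (F a b) (G a b)))
                             (∑-distrib-+ (λ b → ∑[ c < _ ] F a b c) (λ b → ∑[ c < _ ] G a b c))))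
    (∑-distrib-+ (λ a → ∑² (F a)) (λ a → ∑² (G a)))

  ∑⁴-distrib-+ : ∀ {n} (F G : Fin n → Fin n → Fin n → Fin n → ℕ) →
    ∑⁴ (λ a b c d → F a b c d + G a b c d) ≡ ∑⁴ F + ∑⁴ G
  ∑⁴-distrib-+ F G =
    trans (sum-cong-≗ (λ a → ∑³-distrib-+ (F a) (G a))) (∑-distrib-+ (λ a → ∑³ (F a)) (λ a → ∑³ (G a)))

  ∑³-mono-≤ : ∀ {n} {F G : Fin n → Fin n → Fin n → ℕ} →
    (∀ a b c → F a b c ≤ G a b c) → ∑³ F ≤ ∑³ G
  ∑³-mono-≤ F≤G = ∑-mono-≤ λ a → ∑-mono-≤ λ b → ∑-mono-≤ λ c → F≤G a b c

  ∑⁴-mono-≤ : ∀ {n} {F G : Fin n → Fin n → Fin n → Fin n → ℕ} →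
    (∀ a b c d → F a b c d ≤ G a b c d) → ∑⁴ F ≤ ∑⁴ G
  ∑⁴-mono-≤ F≤G = ∑-mono-≤ λ a → ∑³-mono-≤ (F≤G a)

  ∑³-swap₁₂ : ∀ {n} (F : Fin n → Fin n → Fin n → ℕ) → ∑³ (λ a b c → F b a c) ≡ ∑³ F
  ∑³-swap₁₂ F = ∑-comm (λ a b → ∑[ c < _ ] F b a c)

  ∑³-swap₂₃ : ∀ {n} (F : Fin n → Fin n → Fin n → ℕ) → ∑³ (λ a b c → F a c b) ≡ ∑³ F
  ∑³-swap₂₃ F = sum-cong-≗ (λ a → ∑-comm (λ b c → F a c b))

  symmetrise : ∀ {n} → (Fin n → Fin n → Fin n → ℕ) → Fin n → Fin n → Fin n → ℕ
  symmetrise F a b c = F a b c + F a c b + F b a c + F b c a + F c a b + F c b a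

  ∑³-symmetrise : ∀ {n} (F : Fin n → Fin n → Fin n → ℕ) → ∑³ (symmetrise F) ≡ 6 * ∑³ F
  ∑³-symmetrise {n} F = begin
    ∑³ (symmetrise F)
      ≡⟨ trans (∑³-distrib-+ _ F₃₂₁) (cong (_+ ∑³ F₃₂₁)
         (trans (∑³-distrib-+ _ F₃₁₂) (cong (_+ ∑³ F₃₁₂)
         (trans (∑³-distrib-+ _ F₂₃₁) (cong (_+ ∑³ F₂₃₁)
         (trans (∑³-distrib-+ _ F₂₁₃) (cong (_+ ∑³ F₂₁₃)
         (∑³-distrib-+ F F₁₃₂)))))))) ⟩
    ∑³ F + ∑³ F₁₃₂ + ∑³ F₂₁₃ + ∑³ F₂₃₁ + ∑³ F₃₁₂ + ∑³ F₃₂₁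
      ≡⟨ cong₂ _+_ (cong₂ _+_ (cong₂ _+_ (cong₂ _+_ (cong (∑³ F +_) ∑F₁₃₂) ∑F₂₁₃) ∑F₂₃₁) ∑F₃₁₂) ∑F₃₂₁ ⟩
    ∑³ F + ∑³ F + ∑³ F + ∑³ F + ∑³ F + ∑³ F
      ≡⟨ six-copies (∑³ F) ⟩
    6 * ∑³ F ∎
    where
    open ≡-Reasoning
    F₁₃₂ F₂₁₃ F₂₃₁ F₃₁₂ F₃₂₁ : Fin n → Fin n → Fin n → ℕ
    F₁₃₂ a b c = F a c b
    F₂₁₃ a b c = F b a c
    F₂₃₁ a b c = F b c a
    F₃₁₂ a b c = F c a b
    F₃₂₁ a b c = F c b a
    ∑F₁₃₂ : ∑³ F₁₃₂ ≡ ∑³ F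
    ∑F₁₃₂ = ∑³-swap₂₃ F
    ∑F₂₁₃ : ∑³ F₂₁₃ ≡ ∑³ F
    ∑F₂₁₃ = ∑³-swap₁₂ F
    ∑F₂₃₁ : ∑³ F₂₃₁ ≡ ∑³ F
    ∑F₂₃₁ = trans (∑³-swap₁₂ F₁₃₂) ∑F₁₃₂
    ∑F₃₁₂ : ∑³ F₃₁₂ ≡ ∑³ F
    ∑F₃₁₂ = trans (∑³-swap₂₃ F₂₁₃) ∑F₂₁₃
    ∑F₃₂₁ : ∑³ F₃₂₁ ≡ ∑³ F
    ∑F₃₂₁ = trans (∑³-swap₂₃ F₂₃₁) ∑F₂₃₁
    six-copies : ∀ t → t + t + t + t + t + t ≡ 6 * t
    six-copies = solve-∀

  increasing³ : ∀ {n} → Fin n → Fin n → Fin n → ℕ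
  increasing³ a b c = ind (a <? b) * ind (b <? c)

  #increasing³ : ℕ → ℕ
  #increasing³ n = ∑³ (increasing³ {n})

  increasing³-pos : ∀ {n} {a b c : Fin n} → a < b → b < c → 1 ≤ increasing³ a b c
  increasing³-pos a<b b<c = *-mono-≤ (ind-pos (_ <? _) a<b) (ind-pos (_ <? _) b<c)

  symmetrise-increasing³≤1 : ∀ {n} (a b c : Fin n) → symmetrise increasing³ a b c ≤ 1
  symmetrise-increasing³≤1 a b c with a <? b | b <? a | b <? c | c <? b | a <? c | c <? a
  ... | yes p | yes q | _ | _ | _ | _ = contradiction q (<-asym p)
  ... | _ | _ | yes p | yes q | _ | _ = contradiction q (<-asym p)
  ... | _ | _ | _ | _ | yes p | yes q = contradiction q (<-asym p)
  ... | yes ab | no _ | yes bc | no _ | no _ | yes ca = contradiction ca (<-asym (<-trans ab bc))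
  ... | no _ | yes ba | no _ | yes cb | yes ac | no _ = contradiction ac (<-asym (<-trans cb ba))
  ... | yes _ | no _ | yes _ | no _ | yes _ | no _ = s≤s z≤n
  ... | yes _ | no _ | yes _ | no _ | no _ | no _ = s≤s z≤n
  ... | yes _ | no _ | no _ | yes _ | yes _ | no _ = s≤s z≤n
  ... | yes _ | no _ | no _ | yes _ | no _ | yes _ = s≤s z≤n
  ... | yes _ | no _ | no _ | yes _ | no _ | no _ = z≤n
  ... | yes _ | no _ | no _ | no _ | yes _ | no _ = z≤n
  ... | yes _ | no _ | no _ | no _ | no _ | yes _ = s≤s z≤n
  ... | yes _ | no _ | no _ | no _ | no _ | no _ = z≤n
  ... | no _ | yes _ | yes _ | no _ | yes _ | no _ = s≤s z≤n
  ... | no _ | yes _ | yes _ | no _ | no _ | yes _ = s≤s z≤n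
  ... | no _ | yes _ | yes _ | no _ | no _ | no _ = z≤n
  ... | no _ | yes _ | no _ | yes _ | no _ | yes _ = s≤s z≤n
  ... | no _ | yes _ | no _ | yes _ | no _ | no _ = s≤s z≤n
  ... | no _ | yes _ | no _ | no _ | yes _ | no _ = s≤s z≤n
  ... | no _ | yes _ | no _ | no _ | no _ | yes _ = z≤n
  ... | no _ | yes _ | no _ | no _ | no _ | no _ = z≤n
  ... | no _ | no _ | yes _ | no _ | yes _ | no _ = z≤n
  ... | no _ | no _ | yes _ | no _ | no _ | yes _ = s≤s z≤n
  ... | no _ | no _ | yes _ | no _ | no _ | no _ = z≤n
  ... | no _ | no _ | no _ | yes _ | yes _ | no _ = s≤s z≤n
  ... | no _ | no _ | no _ | yes _ | no _ | yes _ = z≤n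
  ... | no _ | no _ | no _ | yes _ | no _ | no _ = z≤n
  ... | no _ | no _ | no _ | no _ | yes _ | no _ = z≤n
  ... | no _ | no _ | no _ | no _ | no _ | yes _ = z≤n
  ... | no _ | no _ | no _ | no _ | no _ | no _ = z≤n

  6*#increasing³≤n³ : ∀ n → 6 * #increasing³ n ≤ n * n * n
  6*#increasing³≤n³ n = begin
    6 * #increasing³ n               ≡⟨ ∑³-symmetrise (increasing³ {n}) ⟨
    ∑³ (symmetrise (increasing³ {n}))  ≤⟨ ∑³-mono-≤ {n} symmetrise-increasing³≤1 ⟩
    ∑³ {n} (λ _ _ _ → 1)               ≡⟨ ∑³-const ⟩
    n * n * n                      ∎
    where
    open ≤-Reasoning
    ∑³-const : ∑³ {n} (λ _ _ _ → 1) ≡ n * n * n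
    ∑³-const = begin-equality
      ∑[ a < n ] ∑[ b < n ] ∑[ c < n ] 1
        ≡⟨ sum-cong-≗ {n} (λ a → trans (sum-cong-≗ {n} (λ b → ∑-const n 1)) (∑-const n (n * 1))) ⟩
      ∑[ a < n ] (n * (n * 1))       ≡⟨ ∑-const n _ ⟩
      n * (n * (n * 1))             ≡⟨ cube n ⟩
      n * n * n                       ∎
      where
      cube : ∀ m → m * (m * (m * 1)) ≡ m * m * m
      cube = solve-∀

  module _ {n} (χ : Fin n → ℕ) (I : Fin n → Fin n → Fin n → ℕ) where

    ∑⁴-weight₁ : ∑⁴ (λ a b c d → χ a * I b c d) ≡ (∑[ i < n ] χ i) * ∑³ I
    ∑⁴-weight₁ = trans (sum-cong-≗ (λ a → ∑³-*ˡ (χ a) I)) (∑-*ʳ (∑³ I) χ)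

    ∑⁴-weight₂ : ∑⁴ (λ a b c d → χ b * I a c d) ≡ (∑[ i < n ] χ i) * ∑³ I
    ∑⁴-weight₂ = trans
      (sum-cong-≗ (λ a → trans (sum-cong-≗ (λ b → ∑²-*ˡ (χ b) (I a))) (∑-*ʳ (∑² (I a)) χ)))
      (∑-*ˡ (∑[ i < n ] χ i) (λ a → ∑² (I a)))

    ∑⁴-weight₃ : ∑⁴ (λ a b c d → χ c * I a b d) ≡ (∑[ i < n ] χ i) * ∑³ I
    ∑⁴-weight₃ = trans
      (sum-cong-≗ (λ a → sum-cong-≗ (λ b →
        trans (sum-cong-≗ (λ c → ∑-*ˡ (χ c) (I a b))) (∑-*ʳ (∑[ d < n ] I a b d) χ))))
      (∑²-*ˡ (∑[ i < n ] χ i) (λ a b → ∑[ d < n ] I a b d))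

    ∑⁴-weight₄ : ∑⁴ (λ a b c d → χ d * I a b c) ≡ (∑[ i < n ] χ i) * ∑³ I
    ∑⁴-weight₄ = trans
      (sum-cong-≗ (λ a → sum-cong-≗ (λ b → sum-cong-≗ (λ c → ∑-*ʳ (I a b c) χ))))
      (∑³-*ˡ (∑[ i < n ] χ i) I)

  -- On an increasing quadruple this is χ a + χ b + χ c + χ d; weighting each entry by the
  -- indicator that the other three increase makes the sum over all quadruples factor.
  touching : ∀ {n} → (Fin n → ℕ) → Fin n → Fin n → Fin n → Fin n → ℕ
  touching χ a b c d =
    χ a * increasing³ b c d + χ b * increasing³ a c d +
    χ c * increasing³ a b d + χ d * increasing³ a b c

  ∑⁴-touching : ∀ {n} (χ : Fin n → ℕ) → ∑⁴ (touching χ) ≡ 4 * ((∑[ i < n ] χ i) * #increasing³ n)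
  ∑⁴-touching {n} χ = begin
    ∑⁴ (touching χ)
      ≡⟨ trans (∑⁴-distrib-+ _ T₄) (cong (_+ ∑⁴ T₄)
         (trans (∑⁴-distrib-+ _ T₃) (cong (_+ ∑⁴ T₃)
         (∑⁴-distrib-+ T₁ T₂)))) ⟩
    ∑⁴ T₁ + ∑⁴ T₂ + ∑⁴ T₃ + ∑⁴ T₄
      ≡⟨ cong₂ _+_ (cong₂ _+_ (cong₂ _+_ (∑⁴-weight₁ χ increasing³) (∑⁴-weight₂ χ increasing³))
                                  (∑⁴-weight₃ χ increasing³)) (∑⁴-weight₄ χ increasing³) ⟩
    s + s + s + s
      ≡⟨ four-copies s ⟩
    4 * s ∎
    where
    open ≡-Reasoning
    s = (∑[ i < n ] χ i) * #increasing³ n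
    T₁ T₂ T₃ T₄ : Fin n → Fin n → Fin n → Fin n → ℕ
    T₁ a b c d = χ a * increasing³ b c d
    T₂ a b c d = χ b * increasing³ a c d
    T₃ a b c d = χ c * increasing³ a b d
    T₄ a b c d = χ d * increasing³ a b c
    four-copies : ∀ t → t + t + t + t ≡ 4 * t
    four-copies = solve-∀

  mismatch : ∀ {n} → Perm n → Perm n → Fin n → ℕ
  mismatch u v i = ind (¬? (u ⟨$⟩ʳ i ≟ v ⟨$⟩ʳ i))

  distance : ∀ {n} → Perm n → Perm n → ℕ
  distance {n} u v = ∑[ i < n ] mismatch u v i

  Pat2143-transfer : ∀ {n} (u v : Perm n) {a b c d} →
    u ⟨$⟩ʳ a ≡ v ⟨$⟩ʳ a → u ⟨$⟩ʳ b ≡ v ⟨$⟩ʳ b → u ⟨$⟩ʳ c ≡ v ⟨$⟩ʳ c → u ⟨$⟩ʳ d ≡ v ⟨$⟩ʳ d →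
    Pat2143 u a b c d → Pat2143 v a b c d
  Pat2143-transfer u v ea eb ec ed (a<b , b<c , c<d , ub<ua , ua<ud , ud<uc) =
    a<b , b<c , c<d , subst₂ _<_ eb ea ub<ua , subst₂ _<_ ea ed ua<ud , subst₂ _<_ ed ec ud<uc

  touching-pos : ∀ {n} (χ : Fin n → ℕ) {a b c d} → a < b → b < c → c < d →
    1 ≤ χ a ⊎ 1 ≤ χ b ⊎ 1 ≤ χ c ⊎ 1 ≤ χ d → 1 ≤ touching χ a b c d
  touching-pos χ a<b b<c c<d (inj₁ χa) =
    +-mono-≤ (+-mono-≤ (+-mono-≤ (*-mono-≤ χa (increasing³-pos b<c c<d)) z≤n) z≤n) z≤n
  touching-pos χ {a} {b} {c} {d} a<b b<c c<d (inj₂ (inj₁ χb)) =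
    +-mono-≤ (+-mono-≤ (+-mono-≤ {y = χ a * increasing³ b c d} z≤n
      (*-mono-≤ χb (increasing³-pos (<-trans a<b b<c) c<d))) z≤n) z≤n
  touching-pos χ {a} {b} {c} {d} a<b b<c c<d (inj₂ (inj₂ (inj₁ χc))) =
    +-mono-≤ (+-mono-≤ {y = χ a * increasing³ b c d + χ b * increasing³ a c d} z≤n
      (*-mono-≤ χc (increasing³-pos a<b (<-trans b<c c<d)))) z≤n
  touching-pos χ a<b b<c c<d (inj₂ (inj₂ (inj₂ χd))) =
    +-mono-≤ z≤n (*-mono-≤ χd (increasing³-pos a<b b<c))

  module _ {n} (u v : Perm n) where

    mismatch-pos : ∀ {i} → ¬ u ⟨$⟩ʳ i ≡ v ⟨$⟩ʳ i → 1 ≤ mismatch u v i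
    mismatch-pos {i} = ind-pos (¬? (u ⟨$⟩ʳ i ≟ v ⟨$⟩ʳ i))

    mismatch≡0 : ∀ {i} → u ⟨$⟩ʳ i ≡ v ⟨$⟩ʳ i → mismatch u v i ≡ 0
    mismatch≡0 {i} u≡v = ind≡0 (¬? (u ⟨$⟩ʳ i ≟ v ⟨$⟩ʳ i)) (λ u≢v → u≢v u≡v)

    -- The decisions are arguments, not `with`-scrutinees of `occurrence≤`: there they would
    -- also be abstracted inside the unfolded `mismatch`, breaking the types of `mismatch-pos`.
    survives-or-touched : ∀ {a b c d} → Pat2143 u a b c d →
      Dec (u ⟨$⟩ʳ a ≡ v ⟨$⟩ʳ a) → Dec (u ⟨$⟩ʳ b ≡ v ⟨$⟩ʳ b) →
      Dec (u ⟨$⟩ʳ c ≡ v ⟨$⟩ʳ c) → Dec (u ⟨$⟩ʳ d ≡ v ⟨$⟩ʳ d) →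
      Pat2143 v a b c d ⊎ 1 ≤ touching (mismatch u v) a b c d
    survives-or-touched occ (yes ea) (yes eb) (yes ec) (yes ed) = inj₁ (Pat2143-transfer u v ea eb ec ed occ)
    survives-or-touched (a<b , b<c , c<d , _) (no ≢a) _ _ _ =
      inj₂ (touching-pos (mismatch u v) a<b b<c c<d (inj₁ (mismatch-pos ≢a)))
    survives-or-touched (a<b , b<c , c<d , _) (yes _) (no ≢b) _ _ =
      inj₂ (touching-pos (mismatch u v) a<b b<c c<d (inj₂ (inj₁ (mismatch-pos ≢b))))
    survives-or-touched (a<b , b<c , c<d , _) (yes _) (yes _) (no ≢c) _ =
      inj₂ (touching-pos (mismatch u v) a<b b<c c<d (inj₂ (inj₂ (inj₁ (mismatch-pos ≢c)))))
    survives-or-touched (a<b , b<c , c<d , _) (yes _) (yes _) (yes _) (no ≢d) =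
      inj₂ (touching-pos (mismatch u v) a<b b<c c<d (inj₂ (inj₂ (inj₂ (mismatch-pos ≢d)))))

    occurrence≤ : ∀ a b c d →
      ind (pat2143? u a b c d) ≤ ind (pat2143? v a b c d) + touching (mismatch u v) a b c d
    occurrence≤ a b c d with pat2143? u a b c d
    ... | no _ = z≤n
    ... | yes occ with survives-or-touched occ (u ⟨$⟩ʳ a ≟ v ⟨$⟩ʳ a) (u ⟨$⟩ʳ b ≟ v ⟨$⟩ʳ b)
                                               (u ⟨$⟩ʳ c ≟ v ⟨$⟩ʳ c) (u ⟨$⟩ʳ d ≟ v ⟨$⟩ʳ d)
    ...   | inj₁ occ′ = ≤-trans (ind-pos (pat2143? v a b c d) occ′) (m≤m+n _ _)
    ...   | inj₂ hit  = ≤-trans hit (m≤n+m _ (ind (pat2143? v a b c d)))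

  N2143≡∑⁴ : ∀ n (v : Perm n) → N2143 n v ≡ ∑⁴ (λ a b c d → ind (pat2143? v a b c d))
  N2143≡∑⁴ n v =
    trans (Σ≡∑ n _) (sum-cong-≗ {n} λ a → trans (Σ≡∑ n _) (sum-cong-≗ {n} λ b →
    trans (Σ≡∑ n _) (sum-cong-≗ {n} λ c → Σ≡∑ n (λ d → ind (pat2143? v a b c d)))))

  N2143≤N2143+distance : ∀ {n} (u v : Perm n) →
    N2143 n u ≤ N2143 n v + 4 * (distance u v * #increasing³ n)
  N2143≤N2143+distance {n} u v = begin
    N2143 n u
      ≡⟨ N2143≡∑⁴ n u ⟩
    ∑⁴ (λ a b c d → ind (pat2143? u a b c d))
      ≤⟨ ∑⁴-mono-≤ (occurrence≤ u v) ⟩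
    ∑⁴ (λ a b c d → ind (pat2143? v a b c d) + touching (mismatch u v) a b c d)
      ≡⟨ ∑⁴-distrib-+ _ (touching (mismatch u v)) ⟩
    ∑⁴ (λ a b c d → ind (pat2143? v a b c d)) + ∑⁴ (touching (mismatch u v))
      ≡⟨ cong₂ _+_ (sym (N2143≡∑⁴ n v)) (∑⁴-touching (mismatch u v)) ⟩
    N2143 n v + 4 * (distance u v * #increasing³ n) ∎
    where open ≤-Reasoning

  distance≤ : ∀ {n k} (u v : Perm n) (ps : Fin k → Fin n) →
    (∀ i → (∀ j → ¬ i ≡ ps j) → u ⟨$⟩ʳ i ≡ v ⟨$⟩ʳ i) → distance u v ≤ k
  distance≤ {n} {k} u v ps agree = begin
    ∑[ i < n ] mismatch u v i            ≤⟨ ∑-mono-≤ mismatch≤ ⟩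
    ∑[ i < n ] ∑[ j < k ] ind (i ≟ ps j) ≡⟨ ∑-comm (λ i j → ind (i ≟ ps j)) ⟩
    ∑[ j < k ] ∑[ i < n ] ind (i ≟ ps j) ≡⟨ sum-cong-≗ (∑-indicator ∘ ps) ⟩
    ∑[ j < k ] 1                         ≡⟨ ∑-const k 1 ⟩
    k * 1                                ≡⟨ *-identityʳ k ⟩
    k                                    ∎
    where
    open ≤-Reasoning
    mismatch≤ : ∀ i → mismatch u v i ≤ ∑[ j < k ] ind (i ≟ ps j)
    mismatch≤ i with any? (λ j → i ≟ ps j)
    ... | yes (j , i≡psj) = ≤-trans (ind≤1 _) (≤-trans (ind-pos (i ≟ ps j) i≡psj) (term≤∑ _ j))
    ... | no untouched    =
      ≤-trans (≤-reflexive (mismatch≡0 u v (agree i λ j i≡psj → untouched (j , i≡psj)))) z≤n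

  transitionFun-outside : ∀ {n} (w : Perm n) x y c i →
    ¬ i ≡ c → ¬ i ≡ x → ¬ i ≡ w ⟨$⟩ˡ y → transitionFun w x y c i ≡ w ⟨$⟩ʳ i
  transitionFun-outside w x y c i i≢c i≢x i≢x′ with i ≟ c
  ... | yes i≡c = contradiction i≡c i≢c
  ... | no _ with i ≟ x
  ...   | yes i≡x = contradiction i≡x i≢x
  ...   | no _ with i ≟ w ⟨$⟩ˡ y
  ...     | yes i≡x′ = contradiction i≡x′ i≢x′
  ...     | no _     = refl

  distance-child≤3 : ∀ {n} (u u′ : Perm n) → Child u u′ → distance u u′ ≤ 3
  distance-child≤3 u u′ (_ , x , y , c , _ , _ , u′≡) =
    distance≤ u u′ (c ∷ x ∷ (u ⟨$⟩ˡ y) ∷ []) λ i avoids →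
      sym (trans (u′≡ i)
        (transitionFun-outside u x y c i (avoids zero) (avoids (suc zero)) (avoids (suc (suc zero)))))

  n≤3*n*n : ∀ n → n ≤ 3 * n * n
  n≤3*n*n zero    = z≤n
  n≤3*n*n (suc n) = m≤n*m (suc n) (3 * suc n)

  N2143-child : ∀ {n} (u u′ : Perm n) → Child u u′ → N2143 n u ≤ N2143 n u′ + 2 * n * n * n
  N2143-child {n} u u′ u⇝u′ = begin
    N2143 n u                                ≤⟨ N2143≤N2143+distance u u′ ⟩
    N2143 n u′ + 4 * (distance u u′ * T)     ≤⟨ +-monoʳ-≤ (N2143 n u′) (*-monoʳ-≤ 4 (*-monoˡ-≤ T d≤3)) ⟩
    N2143 n u′ + 4 * (3 * T)                 ≡⟨ cong (N2143 n u′ +_) (regroup T) ⟩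
    N2143 n u′ + 2 * (6 * T)                 ≤⟨ +-monoʳ-≤ (N2143 n u′) (*-monoʳ-≤ 2 (6*#increasing³≤n³ n)) ⟩
    N2143 n u′ + 2 * (n * n * n)             ≡⟨ cong (N2143 n u′ +_) (reassoc n) ⟩
    N2143 n u′ + 2 * n * n * n               ∎
    where
    open ≤-Reasoning
    T = #increasing³ n
    d≤3 = distance-child≤3 u u′ u⇝u′
    regroup : ∀ t → 4 * (3 * t) ≡ 2 * (6 * t)
    regroup = solve-∀
    reassoc : ∀ m → 2 * (m * m * m) ≡ 2 * m * m * m
    reassoc = solve-∀

  N2143-child-cubic : ∀ {n} (u u′ : Perm n) → Child u u′ →
    n + N2143 n u ≤ (2 * n * n * n + 3 * n * n) + N2143 n u′
  N2143-child-cubic {n} u u′ u⇝u′ =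
    ≤-trans (+-mono-≤ (n≤3*n*n n) (N2143-child u u′ u⇝u′))
            (≤-reflexive (rearrange (3 * n * n) (N2143 n u′) (2 * n * n * n)))
    where
    rearrange : ∀ a b c → a + (b + c) ≡ c + a + b
    rearrange = solve-∀

open import Data.Integer using (+_; _-_; _⊖_; _≤_; _*_; _+_)
open import Data.Integer.Properties as ℤ using (pos-+; pos-*; [+m]-[+n]≡m⊖n; +-cancelˡ-⊖; ⊖-monoˡ-≤)

p+m≤o+n⇒m⊖n≤o⊖p : ∀ {m n o p} → p ℕ.+ m ℕ.≤ o ℕ.+ n → m ⊖ n ≤ o ⊖ p
p+m≤o+n⇒m⊖n≤o⊖p {m} {n} {o} {p} p+m≤o+n = begin
  m ⊖ n                   ≡⟨ +-cancelˡ-⊖ p m n ⟨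
  (p ℕ.+ m) ⊖ (p ℕ.+ n)   ≤⟨ ⊖-monoˡ-≤ (p ℕ.+ n) p+m≤o+n ⟩
  (o ℕ.+ n) ⊖ (p ℕ.+ n)   ≡⟨ cong₂ _⊖_ (ℕ.+-comm o n) (ℕ.+-comm p n) ⟩
  (n ℕ.+ o) ⊖ (n ℕ.+ p)   ≡⟨ +-cancelˡ-⊖ n o p ⟩
  o ⊖ p                   ∎
  where open ℤ.≤-Reasoning

cubic≡ : ∀ n → (+ 2) * (+ n) * (+ n) * (+ n) + (+ 3) * (+ n) * (+ n) - (+ n)
             ≡ (2 ℕ.* n ℕ.* n ℕ.* n ℕ.+ 3 ℕ.* n ℕ.* n) ⊖ n
cubic≡ n = begin
  (+ 2) * (+ n) * (+ n) * (+ n) + (+ 3) * (+ n) * (+ n) - (+ n)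
    ≡⟨ cong (_- + n) (cong₂ _+_ (trans (pos-* (2 ℕ.* n ℕ.* n) n) (cong (_* + n) (pos-*² 2))) (pos-*² 3)) ⟨
  + (2 ℕ.* n ℕ.* n ℕ.* n) + + (3 ℕ.* n ℕ.* n) - (+ n)
    ≡⟨ cong (_- + n) (pos-+ (2 ℕ.* n ℕ.* n ℕ.* n) (3 ℕ.* n ℕ.* n)) ⟨
  + (2 ℕ.* n ℕ.* n ℕ.* n ℕ.+ 3 ℕ.* n ℕ.* n) - (+ n)
    ≡⟨ [+m]-[+n]≡m⊖n _ n ⟩
  (2 ℕ.* n ℕ.* n ℕ.* n ℕ.+ 3 ℕ.* n ℕ.* n) ⊖ n ∎
  where
  open ≡-Reasoning
  pos-*² : ∀ k → + (k ℕ.* n ℕ.* n) ≡ (+ k) * (+ n) * (+ n)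
  pos-*² k = trans (pos-* (k ℕ.* n) n) (cong (_* + n) (pos-* k n))

lemma3p6 : (n : ℕ) (w u u' : Perm n) → InTree w u → Child u u' →
    (+ N2143 n u) - (+ N2143 n u') ≤ (+ 2) * (+ n) * (+ n) * (+ n) + (+ 3) * (+ n) * (+ n) - (+ n)
lemma3p6 n _ u u' _ u⇝u' = begin
  (+ N2143 n u) - (+ N2143 n u')       ≡⟨ [+m]-[+n]≡m⊖n (N2143 n u) (N2143 n u') ⟩
  N2143 n u ⊖ N2143 n u'               ≤⟨ p+m≤o+n⇒m⊖n≤o⊖p {p = n} (N2143-child-cubic u u' u⇝u') ⟩
  (2 ℕ.* n ℕ.* n ℕ.* n ℕ.+ 3 ℕ.* n ℕ.* n) ⊖ n ≡⟨ cubic≡ n ⟨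
  (+ 2) * (+ n) * (+ n) * (+ n) + (+ 3) * (+ n) * (+ n) - (+ n) ∎
  where open ℤ.≤-Reasoning
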